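{- Let $\mathbf a=(a_0,a_1,\ldots)$ be an integer sequence. Define two triangular arrays $L_{n,k}$, $R_{n,k}$ ($0\le k\le n$) and sequences $\mathbf m=(m_0,m_1,\ldots)$, $\mathbf b=(b_0,b_1,\ldots)$ by the conditions, for all $i\ge0$: $$L_{2i,0}=a_{2i},\quad R_{2i+1,0}=a_{2i+1},\quad L_{2i,2i}=R_{2i,0}=m_{2i},\quad L_{2i+1,0}=R_{2i+1,2i+1}=m_{2i+1},$$ $$L_{2i+1,2i+1}=b_{2i+1},\quad R_{2i,2i}=b_{2i},$$ and, for $n\ge k\ge0$, $$L_{n+1,k+1}=L_{n+1,k}+L_{n,n-k},\qquad R_{n+1,k+1}=R_{n+1,k}+R_{n,n-k}.$$ (These conditions determine all entries recursively row by row.) Then the exponential generating functions $\mathcal A(x)=\sum a_nx^n/n!$, $\mathcal M(x)=\sum m_nx^n/n!$, $\mathcal B(x)=\sum b_nx^n/n!$ satisfy $$\mathcal M(x)=\frac{1}{\cos x-\sin x}\,\mathcal A(x),\qquad \mathcal B(x)=\frac{\cos x+\sin x}{\cos x-\sin x}\,\mathcal A(x).$$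
   Context: Generating functions are formal power series. The map $\mathbf a\mapsto\mathbf b$ is called the double-ox transform. -}

module Defs where

open import Data.Nat as ℕ using (ℕ; zero; suc; _∸_; _!)
open import Data.Nat.Properties using (_!≢0)
open import Data.Integer as ℤ using (ℤ; +_; -[1+_])
open import Data.Rational as ℚ using (ℚ; 0ℚ)

-- Formal power series with rational coefficients: x^n has coefficient f n.
Series : Set
Series = ℕ → ℚ

_≈ₛ_ : Series → Series → Set
f ≈ₛ g = ∀ n → f n ≡ g n
  where open import Relation.Binary.PropositionalEquality using (_≡_)

infixl 6 _+ₛ_ _-ₛ_
infixl 7 _*ₛ_

_+ₛ_ : Series → Series → Series
(f +ₛ g) n = f n ℚ.+ g n

_-ₛ_ : Series → Series → Series
(f -ₛ g) n = f n ℚ.- g n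

sumTo : ℕ → (ℕ → ℚ) → ℚ
sumTo zero    h = h 0
sumTo (suc n) h = sumTo n h ℚ.+ h (suc n)

_*ₛ_ : Series → Series → Series
(f *ₛ g) n = sumTo n (λ k → f k ℚ.* g (n ∸ k))

egf : (ℕ → ℤ) → Series
egf a n = (a n ℚ./ (n !)) {{n !≢0}}

-- n-th derivatives at 0 of cos and sin (periodic mod 4)
cosCoeff : ℕ → ℤ
cosCoeff 0 = + 1
cosCoeff 1 = + 0
cosCoeff 2 = -[1+ 0 ]
cosCoeff 3 = + 0
cosCoeff (suc (suc (suc (suc n)))) = cosCoeff n

sinCoeff : ℕ → ℤ
sinCoeff 0 = + 0
sinCoeff 1 = + 1
sinCoeff 2 = + 0
sinCoeff 3 = -[1+ 0 ]
sinCoeff (suc (suc (suc (suc n)))) = sinCoeff n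

cosS : Series
cosS = egf cosCoeff

sinS : Series
sinS = egf sinCoeff

{-# OPTIONS --safe #-}

-- Read row n = p + q of a boustrophedon triangle T at distance q from its left end when n is even
-- and from its right end when n is odd (zigzag T p q). The recurrence becomes
-- zigzag T (p+1) q = zigzag T p (q+1) + (-1)^n zigzag T p q, and multiplying by the 4-periodic
-- sign cos+sin n (the n-th derivative of cos + sin at 0) turns this into Pascal's rule, so the
-- row ends zigzag T n 0 are signed binomial transforms of the column zigzag T 0 j. For L that
-- column is m and the row ends are a and b at even and odd n; the mirrored reading of R does
-- the same with cos-sin. The product rules of the two signs then give a = m ⊛ (cos - sin) and
-- b = m ⊛ (cos + sin) for the binomial convolution ⊛, i.e. M (cos - sin) = A and
-- B (cos - sin) = M (cos + sin) (cos - sin) = (cos + sin) A.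
module Submission where

open import Defs
open import Algebra.Bundles using (CommutativeSemiring; CommutativeRing)
open import Data.Bool using (Bool; true; false; not; if_then_else_)
open import Data.Integer using (ℤ; +_; 1ℤ; -1ℤ)
  renaming (_+_ to _+ℤ_; _*_ to _*ℤ_; _-_ to _-ℤ_; -_ to -ℤ_)
import Data.Integer.Properties as ℤ
open import Data.Integer.Tactic.RingSolver using (solve-∀)
open import Data.Nat using (ℕ; zero; suc; _+_; _*_; _∸_; _≤_; z≤n; _!; NonZero)
open import Data.Nat.Combinatorics
  using (_C_; nCk≡n!/k![n-k]!; k>n⇒nCk≡0; nCk+nC[k+1]≡[n+1]C[k+1]; k![n∸k]!∣n!)
open import Data.Nat.DivMod using (m/n*n≡m)
import Data.Nat.Properties as ℕ
open import Data.Nat.Properties using (_!≢0; _!*_!≢0)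
open import Data.Product using (_×_; _,_; proj₁; proj₂)
open import Data.Rational using (_/_; toℚᵘ; fromℚᵘ)
  renaming (_+_ to _+ℚ_; _*_ to _*ℚ_; _-_ to _-ℚ_; -_ to -ℚ_)
import Data.Rational.Properties as ℚ
open import Data.Rational.Unnormalised using (mkℚᵘ; *≡*)
  renaming (_+_ to _+ᵘ_; _*_ to _*ᵘ_; -_ to -ᵘ_)
import Data.Rational.Unnormalised.Properties as ℚᵘ
open import Function using (_∘_)
open import Relation.Binary.PropositionalEquality
  using (_≡_; refl; sym; trans; cong; cong₂; subst; module ≡-Reasoning)

module FiniteSums {c ℓ} (R : CommutativeSemiring c ℓ) where

  open CommutativeSemiring R
    renaming (_+_ to _+ᴿ_; _*_ to _*ᴿ_; refl to ≈-refl; sym to ≈-sym; trans to ≈-trans)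
  open import Algebra.Properties.CommutativeSemigroup +-commutativeSemigroup using (interchange)
  open import Relation.Binary.Reasoning.Setoid setoid

  ∑ : ℕ → (ℕ → Carrier) → Carrier
  ∑ zero    f = f 0
  ∑ (suc n) f = ∑ n f +ᴿ f (suc n)

  ∑-cong : ∀ n {f g} → (∀ k → k ≤ n → f k ≈ g k) → ∑ n f ≈ ∑ n g
  ∑-cong zero    f≈g = f≈g 0 z≤n
  ∑-cong (suc n) f≈g = +-cong (∑-cong n λ k k≤n → f≈g k (ℕ.m≤n⇒m≤1+n k≤n)) (f≈g (suc n) ℕ.≤-refl)

  ∑-+ : ∀ n f g → ∑ n (λ k → f k +ᴿ g k) ≈ ∑ n f +ᴿ ∑ n g
  ∑-+ zero    f g = ≈-refl
  ∑-+ (suc n) f g = ≈-trans (+-congʳ (∑-+ n f g)) (interchange _ _ _ _)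

  ∑-distribˡ : ∀ n x f → x *ᴿ ∑ n f ≈ ∑ n (λ k → x *ᴿ f k)
  ∑-distribˡ zero    x f = ≈-refl
  ∑-distribˡ (suc n) x f = ≈-trans (distribˡ x _ _) (+-congʳ (∑-distribˡ n x f))

  ∑-distribʳ : ∀ n x f → ∑ n f *ᴿ x ≈ ∑ n (λ k → f k *ᴿ x)
  ∑-distribʳ zero    x f = ≈-refl
  ∑-distribʳ (suc n) x f = ≈-trans (distribʳ x _ _) (+-congʳ (∑-distribʳ n x f))

  ∑-suc : ∀ n f → ∑ (suc n) f ≈ f 0 +ᴿ ∑ n (λ k → f (suc k))
  ∑-suc zero    f = ≈-refl
  ∑-suc (suc n) f = ≈-trans (+-congʳ (∑-suc n f)) (+-assoc _ _ _)

  ∑-reverse : ∀ n f → ∑ n f ≈ ∑ n (λ k → f (n ∸ k))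
  ∑-reverse zero    f = ≈-refl
  ∑-reverse (suc n) f = begin
    ∑ n f +ᴿ f (suc n)                   ≈⟨ +-congʳ (∑-reverse n f) ⟩
    ∑ n (λ k → f (n ∸ k)) +ᴿ f (suc n)   ≈⟨ +-comm _ _ ⟩
    f (suc n) +ᴿ ∑ n (λ k → f (n ∸ k))   ≈⟨ ∑-suc n (λ k → f (suc n ∸ k)) ⟨
    ∑ (suc n) (λ k → f (suc n ∸ k))      ∎

  ∑-triangle : ∀ n (F : ℕ → ℕ → Carrier) →
               ∑ n (λ k → ∑ k (λ j → F j k)) ≈ ∑ n (λ j → ∑ (n ∸ j) (λ i → F j (j + i)))
  ∑-triangle zero    F = ≈-refl
  ∑-triangle (suc n) F = begin
    ∑ (suc n) (λ k → ∑ k (λ j → F j k))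
      ≈⟨ ∑-suc n _ ⟩
    F 0 0 +ᴿ ∑ n (λ k → ∑ (suc k) (λ j → F j (suc k)))
      ≈⟨ +-congˡ (∑-cong n λ k _ → ∑-suc k _) ⟩
    F 0 0 +ᴿ ∑ n (λ k → F 0 (suc k) +ᴿ ∑ k (λ j → F (suc j) (suc k)))
      ≈⟨ +-congˡ (∑-+ n _ _) ⟩
    F 0 0 +ᴿ (∑ n (λ k → F 0 (suc k)) +ᴿ ∑ n (λ k → ∑ k (λ j → F (suc j) (suc k))))
      ≈⟨ +-assoc _ _ _ ⟨
    (F 0 0 +ᴿ ∑ n (λ k → F 0 (suc k))) +ᴿ ∑ n (λ k → ∑ k (λ j → F (suc j) (suc k)))
      ≈⟨ +-cong (≈-sym (∑-suc n (F 0))) (∑-triangle n λ j k → F (suc j) (suc k)) ⟩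
    ∑ (suc n) (F 0) +ᴿ ∑ n (λ j → ∑ (n ∸ j) (λ i → F (suc j) (suc j + i)))
      ≈⟨ ∑-suc n _ ⟨
    ∑ (suc n) (λ j → ∑ (suc n ∸ j) (λ i → F j (j + i))) ∎

  infixl 7 _⋆_

  _⋆_ : (ℕ → Carrier) → (ℕ → Carrier) → ℕ → Carrier
  (f ⋆ g) n = ∑ n (λ k → f k *ᴿ g (n ∸ k))

  ⋆-cong : ∀ {f f′ g g′} → (∀ n → f n ≈ f′ n) → (∀ n → g n ≈ g′ n) → ∀ n → (f ⋆ g) n ≈ (f′ ⋆ g′) n
  ⋆-cong f≈f′ g≈g′ n = ∑-cong n λ k _ → *-cong (f≈f′ k) (g≈g′ (n ∸ k))

  ⋆-comm : ∀ f g n → (f ⋆ g) n ≈ (g ⋆ f) n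
  ⋆-comm f g n = ≈-trans (∑-reverse n _) (∑-cong n λ k k≤n →
    ≈-trans (*-comm _ _) (*-congʳ (reflexive (cong g (ℕ.m∸[m∸n]≡n k≤n)))))

  ⋆-assoc : ∀ f g h n → ((f ⋆ g) ⋆ h) n ≈ (f ⋆ (g ⋆ h)) n
  ⋆-assoc f g h n = begin
    ∑ n (λ k → ∑ k (λ j → f j *ᴿ g (k ∸ j)) *ᴿ h (n ∸ k))
      ≈⟨ ∑-cong n (λ k _ → ∑-distribʳ k _ _) ⟩
    ∑ n (λ k → ∑ k (λ j → f j *ᴿ g (k ∸ j) *ᴿ h (n ∸ k)))
      ≈⟨ ∑-triangle n (λ j k → f j *ᴿ g (k ∸ j) *ᴿ h (n ∸ k)) ⟩
    ∑ n (λ j → ∑ (n ∸ j) (λ i → f j *ᴿ g (j + i ∸ j) *ᴿ h (n ∸ (j + i))))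
      ≈⟨ ∑-cong n (λ j _ → ∑-cong (n ∸ j) λ i _ → reassociate j i) ⟩
    ∑ n (λ j → ∑ (n ∸ j) (λ i → f j *ᴿ (g i *ᴿ h (n ∸ j ∸ i))))
      ≈⟨ ∑-cong n (λ j _ → ∑-distribˡ (n ∸ j) (f j) _) ⟨
    ∑ n (λ j → f j *ᴿ ∑ (n ∸ j) (λ i → g i *ᴿ h (n ∸ j ∸ i))) ∎
    where
    reassociate : ∀ j i → f j *ᴿ g (j + i ∸ j) *ᴿ h (n ∸ (j + i)) ≈ f j *ᴿ (g i *ᴿ h (n ∸ j ∸ i))
    reassociate j i = ≈-trans (*-assoc _ _ _)
      (*-congˡ (*-cong (reflexive (cong g (ℕ.m+n∸m≡n j i))) (reflexive (cong h (sym (ℕ.∸-+-assoc n j i))))))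

  ⋆-exchange : ∀ {m k e a b} → (∀ n → (m ⋆ k) n ≈ a n) → (∀ n → (m ⋆ e) n ≈ b n) →
               ∀ n → (b ⋆ k) n ≈ (e ⋆ a) n
  ⋆-exchange {m} {k} {e} {a} {b} m⋆k≈a m⋆e≈b n = begin
    (b ⋆ k) n        ≈⟨ ⋆-cong {g = k} (λ n → ≈-sym (m⋆e≈b n)) (λ _ → ≈-refl) n ⟩
    ((m ⋆ e) ⋆ k) n  ≈⟨ ⋆-assoc m e k n ⟩
    (m ⋆ (e ⋆ k)) n  ≈⟨ ⋆-cong {f = m} (λ _ → ≈-refl) (⋆-comm e k) n ⟩
    (m ⋆ (k ⋆ e)) n  ≈⟨ ⋆-assoc m k e n ⟨
    ((m ⋆ k) ⋆ e) n  ≈⟨ ⋆-cong {g = e} m⋆k≈a (λ _ → ≈-refl) n ⟩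
    (a ⋆ e) n        ≈⟨ ⋆-comm a e n ⟩
    (e ⋆ a) n        ∎

open FiniteSums ℤ.+-*-commutativeSemiring using (∑; ∑-cong; ∑-+; ∑-suc; ∑-distribˡ)
module ℚΣ = FiniteSums (CommutativeRing.commutativeSemiring ℚ.+-*-commutativeRing)

fromℚᵘ-homo-+ : ∀ p q → fromℚᵘ (p +ᵘ q) ≡ fromℚᵘ p +ℚ fromℚᵘ q
fromℚᵘ-homo-+ p q = ℚ.toℚᵘ-injective (begin
  toℚᵘ (fromℚᵘ (p +ᵘ q))              ≈⟨ ℚ.toℚᵘ-fromℚᵘ (p +ᵘ q) ⟩
  p +ᵘ q                               ≈⟨ ℚᵘ.+-cong (ℚ.toℚᵘ-fromℚᵘ p) (ℚ.toℚᵘ-fromℚᵘ q) ⟨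
  toℚᵘ (fromℚᵘ p) +ᵘ toℚᵘ (fromℚᵘ q)  ≈⟨ ℚ.toℚᵘ-homo-+ (fromℚᵘ p) (fromℚᵘ q) ⟨
  toℚᵘ (fromℚᵘ p +ℚ fromℚᵘ q)         ∎)
  where open ℚᵘ.≃-Reasoning

fromℚᵘ-homo-* : ∀ p q → fromℚᵘ (p *ᵘ q) ≡ fromℚᵘ p *ℚ fromℚᵘ q
fromℚᵘ-homo-* p q = ℚ.toℚᵘ-injective (begin
  toℚᵘ (fromℚᵘ (p *ᵘ q))              ≈⟨ ℚ.toℚᵘ-fromℚᵘ (p *ᵘ q) ⟩
  p *ᵘ q                               ≈⟨ ℚᵘ.*-cong (ℚ.toℚᵘ-fromℚᵘ p) (ℚ.toℚᵘ-fromℚᵘ q) ⟨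
  toℚᵘ (fromℚᵘ p) *ᵘ toℚᵘ (fromℚᵘ q)  ≈⟨ ℚ.toℚᵘ-homo-* (fromℚᵘ p) (fromℚᵘ q) ⟨
  toℚᵘ (fromℚᵘ p *ℚ fromℚᵘ q)         ∎)
  where open ℚᵘ.≃-Reasoning

fromℚᵘ-homo‿- : ∀ p → fromℚᵘ (-ᵘ p) ≡ -ℚ fromℚᵘ p
fromℚᵘ-homo‿- p = ℚ.toℚᵘ-injective (begin
  toℚᵘ (fromℚᵘ (-ᵘ p))  ≈⟨ ℚ.toℚᵘ-fromℚᵘ (-ᵘ p) ⟩
  -ᵘ p                   ≈⟨ ℚᵘ.-‿cong (ℚ.toℚᵘ-fromℚᵘ p) ⟨
  -ᵘ toℚᵘ (fromℚᵘ p)     ≈⟨ ℚ.toℚᵘ-homo‿- (fromℚᵘ p) ⟨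
  toℚᵘ (-ℚ fromℚᵘ p)     ∎)
  where open ℚᵘ.≃-Reasoning

/-cross : ∀ x y m n .{{_ : NonZero m}} .{{_ : NonZero n}} → x *ℤ + n ≡ y *ℤ + m → x / m ≡ y / n
/-cross x y (suc m) (suc n) eq = ℚ.fromℚᵘ-cong {mkℚᵘ x m} {mkℚᵘ y n} (*≡* eq)

*-/ : ∀ x y m n .{{_ : NonZero m}} .{{_ : NonZero n}} →
      (x / m) *ℚ (y / n) ≡ ((x *ℤ y) / (m * n)) {{ℕ.m*n≢0 m n}}
*-/ x y (suc m) (suc n) = sym (fromℚᵘ-homo-* (mkℚᵘ x m) (mkℚᵘ y n))

-‿/ : ∀ x n .{{_ : NonZero n}} → -ℚ (x / n) ≡ (-ℤ x) / n
-‿/ x (suc n) = sym (fromℚᵘ-homo‿- (mkℚᵘ x n))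

+-/ : ∀ x y n .{{_ : NonZero n}} → (x / n) +ℚ (y / n) ≡ (x +ℤ y) / n
+-/ x y n@(suc n-1) = trans (sym (fromℚᵘ-homo-+ (mkℚᵘ x n-1) (mkℚᵘ y n-1)))
  (/-cross (x *ℤ + n +ℤ y *ℤ + n) (x +ℤ y) (n * n) n
           (trans (distrib x y (+ n)) (cong ((x +ℤ y) *ℤ_) (sym (ℤ.pos-* n n)))))
  where
  distrib : ∀ x y d → (x *ℤ d +ℤ y *ℤ d) *ℤ d ≡ (x +ℤ y) *ℤ (d *ℤ d)
  distrib = solve-∀

-/ : ∀ x y n .{{_ : NonZero n}} → (x / n) -ℚ (y / n) ≡ (x -ℤ y) / n
-/ x y n = trans (cong (x / n +ℚ_) (-‿/ y n)) (+-/ x (-ℤ y) n)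

∑-/ : ∀ n (x : ℕ → ℤ) d .{{_ : NonZero d}} → ℚΣ.∑ n (λ k → x k / d) ≡ ∑ n x / d
∑-/ zero    x d = refl
∑-/ (suc n) x d = trans (cong (_+ℚ x (suc n) / d) (∑-/ n x d)) (+-/ (∑ n x) (x (suc n)) d)

nCk*[k!*[n∸k]!]≡n! : ∀ {n k} → k ≤ n → (n C k) * (k ! * (n ∸ k) !) ≡ n !
nCk*[k!*[n∸k]!]≡n! {n} {k} k≤n =
  trans (cong (_* (k ! * (n ∸ k) !)) (nCk≡n!/k![n-k]! k≤n)) (m/n*n≡m (k![n∸k]!∣n! k≤n))
  where instance _ = k !* (n ∸ k) !≢0

∑-binomial-suc : ∀ p (w : ℕ → ℤ) →
  ∑ (suc p) (λ j → + (suc p C j) *ℤ w j) ≡ ∑ p (λ j → + (p C j) *ℤ w (suc j)) +ℤ ∑ p (λ j → + (p C j) *ℤ w j)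
∑-binomial-suc p w = begin
  ∑ (suc p) (λ j → + (suc p C j) *ℤ w j)                  ≡⟨ ∑-suc p _ ⟩
  + 1 *ℤ w 0 +ℤ ∑ p (λ j → + (suc p C suc j) *ℤ w (suc j))  ≡⟨ cong (+ 1 *ℤ w 0 +ℤ_) split ⟩
  + 1 *ℤ w 0 +ℤ (S₁ +ℤ S₂)                                  ≡⟨ +-exchange (+ 1 *ℤ w 0) S₁ S₂ ⟩
  S₁ +ℤ (+ 1 *ℤ w 0 +ℤ S₂)                                  ≡⟨ cong (S₁ +ℤ_) (∑-suc p f) ⟨
  S₁ +ℤ (∑ p f +ℤ + (p C suc p) *ℤ w (suc p))               ≡⟨ cong (S₁ +ℤ_) vanishing ⟩
  S₁ +ℤ ∑ p f                                               ∎
  where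
  open ≡-Reasoning
  f : ℕ → ℤ
  f j = + (p C j) *ℤ w j
  S₁ S₂ : ℤ
  S₁ = ∑ p (λ j → + (p C j) *ℤ w (suc j))
  S₂ = ∑ p (λ j → + (p C suc j) *ℤ w (suc j))
  pascal : ∀ j → + (suc p C suc j) *ℤ w (suc j) ≡ + (p C j) *ℤ w (suc j) +ℤ + (p C suc j) *ℤ w (suc j)
  pascal j = begin
    + (suc p C suc j) *ℤ w (suc j)             ≡⟨ cong (λ c → + c *ℤ w (suc j)) (nCk+nC[k+1]≡[n+1]C[k+1] p j) ⟨
    + (p C j + p C suc j) *ℤ w (suc j)         ≡⟨ cong (_*ℤ w (suc j)) (ℤ.pos-+ (p C j) (p C suc j)) ⟩
    (+ (p C j) +ℤ + (p C suc j)) *ℤ w (suc j)  ≡⟨ ℤ.*-distribʳ-+ (w (suc j)) (+ (p C j)) (+ (p C suc j)) ⟩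
    + (p C j) *ℤ w (suc j) +ℤ + (p C suc j) *ℤ w (suc j) ∎
  split : ∑ p (λ j → + (suc p C suc j) *ℤ w (suc j)) ≡ S₁ +ℤ S₂
  split = trans (∑-cong p λ j _ → pascal j) (∑-+ p _ _)
  vanishing : ∑ p f +ℤ + (p C suc p) *ℤ w (suc p) ≡ ∑ p f
  vanishing = trans (cong (λ c → ∑ p f +ℤ + c *ℤ w (suc p)) (k>n⇒nCk≡0 (ℕ.n<1+n p))) (ℤ.+-identityʳ _)
  +-exchange : ∀ x y z → x +ℤ (y +ℤ z) ≡ y +ℤ (x +ℤ z)
  +-exchange = solve-∀

pascal-expansion : (X : ℕ → ℕ → ℤ) → (∀ p q → X (suc p) q ≡ X p (suc q) +ℤ X p q) →
                   ∀ p q → X p q ≡ ∑ p (λ j → + (p C j) *ℤ X 0 (q + j))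
pascal-expansion X step zero    q = sym (trans (ℤ.*-identityˡ _) (cong (X 0) (ℕ.+-identityʳ q)))
pascal-expansion X step (suc p) q = begin
  X (suc p) q
    ≡⟨ step p q ⟩
  X p (suc q) +ℤ X p q
    ≡⟨ cong₂ _+ℤ_ (trans (pascal-expansion X step p (suc q)) (∑-cong p λ j _ → shift j))
                  (pascal-expansion X step p q) ⟩
  ∑ p (λ j → + (p C j) *ℤ X 0 (q + suc j)) +ℤ ∑ p (λ j → + (p C j) *ℤ X 0 (q + j))
    ≡⟨ ∑-binomial-suc p (λ j → X 0 (q + j)) ⟨
  ∑ (suc p) (λ j → + (suc p C j) *ℤ X 0 (q + j)) ∎
  where
  open ≡-Reasoning
  shift : ∀ j → + (p C j) *ℤ X 0 (suc q + j) ≡ + (p C j) *ℤ X 0 (q + suc j)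
  shift j = cong (λ k → + (p C j) *ℤ X 0 k) (sym (ℕ.+-suc q j))

signed-pascal-expansion : (Y : ℕ → ℕ → ℤ) (ε s : ℕ → ℤ) → (∀ n → s (suc n) *ℤ ε n ≡ s n) →
                          (∀ p q → Y (suc p) q ≡ Y p (suc q) +ℤ ε (p + q) *ℤ Y p q) →
                          ∀ p → s p *ℤ Y p 0 ≡ ∑ p (λ j → + (p C j) *ℤ (s j *ℤ Y 0 j))
signed-pascal-expansion Y ε s sε Y-step p =
  trans (cong (λ k → s k *ℤ Y p 0) (sym (ℕ.+-identityʳ p))) (pascal-expansion X X-step p 0)
  where
  X : ℕ → ℕ → ℤ
  X p q = s (p + q) *ℤ Y p q
  distrib : ∀ a b e c → a *ℤ (b +ℤ e *ℤ c) ≡ a *ℤ b +ℤ (a *ℤ e) *ℤ c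
  distrib = solve-∀
  X-step : ∀ p q → X (suc p) q ≡ X p (suc q) +ℤ X p q
  X-step p q = begin
    s (suc (p + q)) *ℤ Y (suc p) q
      ≡⟨ cong (s (suc (p + q)) *ℤ_) (Y-step p q) ⟩
    s (suc (p + q)) *ℤ (Y p (suc q) +ℤ ε (p + q) *ℤ Y p q)
      ≡⟨ distrib (s (suc (p + q))) (Y p (suc q)) (ε (p + q)) (Y p q) ⟩
    s (suc (p + q)) *ℤ Y p (suc q) +ℤ (s (suc (p + q)) *ℤ ε (p + q)) *ℤ Y p q
      ≡⟨ cong₂ _+ℤ_ (cong (λ k → s k *ℤ Y p (suc q)) (sym (ℕ.+-suc p q)))
                    (cong (_*ℤ Y p q) (sε (p + q))) ⟩
    X p (suc q) +ℤ X p q ∎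
    where open ≡-Reasoning

binomialConv : (ℕ → ℤ) → (ℕ → ℤ) → ℕ → ℤ
binomialConv f g n = ∑ n (λ k → + (n C k) *ℤ (f k *ℤ g (n ∸ k)))

untwist : ∀ n (u m w : ℕ → ℤ) {y} → u n *ℤ u n ≡ 1ℤ →
          u n *ℤ y ≡ ∑ n (λ j → + (n C j) *ℤ (u j *ℤ m j)) →
          (∀ j → j ≤ n → u n *ℤ u j ≡ w (n ∸ j)) →
          y ≡ binomialConv m w n
untwist n u m w {y} unit expansion product = begin
  y                                                ≡⟨ ℤ.*-identityˡ y ⟨
  1ℤ *ℤ y                                          ≡⟨ cong (_*ℤ y) unit ⟨
  u n *ℤ u n *ℤ y                                  ≡⟨ ℤ.*-assoc (u n) (u n) y ⟩
  u n *ℤ (u n *ℤ y)                                ≡⟨ cong (u n *ℤ_) expansion ⟩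
  u n *ℤ ∑ n (λ j → + (n C j) *ℤ (u j *ℤ m j))     ≡⟨ ∑-distribˡ n (u n) _ ⟩
  ∑ n (λ j → u n *ℤ (+ (n C j) *ℤ (u j *ℤ m j)))   ≡⟨ ∑-cong n term ⟩
  binomialConv m w n                               ∎
  where
  open ≡-Reasoning
  rearrange : ∀ a c b x → a *ℤ (c *ℤ (b *ℤ x)) ≡ c *ℤ (x *ℤ (a *ℤ b))
  rearrange = solve-∀
  term : ∀ j → j ≤ n → u n *ℤ (+ (n C j) *ℤ (u j *ℤ m j)) ≡ + (n C j) *ℤ (m j *ℤ w (n ∸ j))
  term j j≤n = trans (rearrange (u n) (+ (n C j)) (u j) (m j))
                     (cong (λ v → + (n C j) *ℤ (m j *ℤ v)) (product j j≤n))

egf-⋆ : ∀ f g n → (egf f ℚΣ.⋆ egf g) n ≡ egf (binomialConv f g) n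
egf-⋆ f g n = trans (ℚΣ.∑-cong n term) (∑-/ n _ (n !) {{n !≢0}})
  where
  term : ∀ k → k ≤ n → egf f k *ℚ egf g (n ∸ k) ≡ ((+ (n C k) *ℤ (f k *ℤ g (n ∸ k))) / n !) {{n !≢0}}
  term k k≤n = trans (*-/ (f k) (g (n ∸ k)) (k !) ((n ∸ k) !) {{k !≢0}} {{(n ∸ k) !≢0}})
                     (/-cross fg (+ (n C k) *ℤ fg) (k ! * (n ∸ k) !) (n !) {{k !* (n ∸ k) !≢0}} {{n !≢0}} cross)
    where
    fg : ℤ
    fg = f k *ℤ g (n ∸ k)
    rearrange : ∀ x c d → x *ℤ (c *ℤ d) ≡ (c *ℤ x) *ℤ d
    rearrange = solve-∀
    cross : fg *ℤ + (n !) ≡ (+ (n C k) *ℤ fg) *ℤ + (k ! * (n ∸ k) !)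
    cross = begin
      fg *ℤ + (n !)                             ≡⟨ cong (λ d → fg *ℤ + d) (nCk*[k!*[n∸k]!]≡n! k≤n) ⟨
      fg *ℤ + ((n C k) * (k ! * (n ∸ k) !))     ≡⟨ cong (fg *ℤ_) (ℤ.pos-* (n C k) _) ⟩
      fg *ℤ (+ (n C k) *ℤ + (k ! * (n ∸ k) !))  ≡⟨ rearrange fg (+ (n C k)) _ ⟩
      (+ (n C k) *ℤ fg) *ℤ + (k ! * (n ∸ k) !)  ∎
      where open ≡-Reasoning

sumTo≡∑ : ∀ n h → sumTo n h ≡ ℚΣ.∑ n h
sumTo≡∑ zero    h = refl
sumTo≡∑ (suc n) h = cong (_+ℚ h (suc n)) (sumTo≡∑ n h)

*ₛ≈⋆ : ∀ f g → (f *ₛ g) ≈ₛ (f ℚΣ.⋆ g)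
*ₛ≈⋆ f g n = sumTo≡∑ n _

egf-cong : ∀ {f g} → (∀ n → f n ≡ g n) → egf f ≈ₛ egf g
egf-cong f≡g n = cong (λ z → (z / n !) {{n !≢0}}) (f≡g n)

+ₛ-egf : ∀ f g → (egf f +ₛ egf g) ≈ₛ egf (λ n → f n +ℤ g n)
+ₛ-egf f g n = +-/ (f n) (g n) (n !) {{n !≢0}}

-ₛ-egf : ∀ f g → (egf f -ₛ egf g) ≈ₛ egf (λ n → f n -ℤ g n)
-ₛ-egf f g n = -/ (f n) (g n) (n !) {{n !≢0}}

isEven : ℕ → Bool
isEven zero          = true
isEven (suc zero)    = false
isEven (suc (suc n)) = isEven n

isEven-suc : ∀ n → isEven (suc n) ≡ not (isEven n)
isEven-suc zero          = refl
isEven-suc (suc zero)    = refl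
isEven-suc (suc (suc n)) = isEven-suc n

private variable A B : Set

pick : ℕ → A → A → A
pick n x y = if isEven n then x else y

pick-same : ∀ n {x : A} → pick n x x ≡ x
pick-same n with isEven n
... | true  = refl
... | false = refl

pick-cong : ∀ {x x′ y y′ : ℕ → A} →
            (∀ i → x (2 * i) ≡ x′ (2 * i)) → (∀ i → y (2 * i + 1) ≡ y′ (2 * i + 1)) →
            ∀ n → pick n (x n) (y n) ≡ pick n (x′ n) (y′ n)
pick-cong x≡x′ y≡y′ zero          = x≡x′ 0
pick-cong x≡x′ y≡y′ (suc zero)    = y≡y′ 0
pick-cong {x = x} {x′} {y} {y′} x≡x′ y≡y′ (suc (suc n)) =
  pick-cong {x = x ∘ suc ∘ suc} {x′ ∘ suc ∘ suc} {y ∘ suc ∘ suc} {y′ ∘ suc ∘ suc}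
    (λ i → subst (λ k → x k ≡ x′ k) (ℕ.*-suc 2 i) (x≡x′ (suc i)))
    (λ i → subst (λ k → y k ≡ y′ k) (cong (_+ 1) (ℕ.*-suc 2 i)) (y≡y′ (suc i)))
    n

pick-elim : ∀ {x y z : ℕ → A} →
            (∀ i → x (2 * i) ≡ z (2 * i)) → (∀ i → y (2 * i + 1) ≡ z (2 * i + 1)) →
            ∀ n → pick n (x n) (y n) ≡ z n
pick-elim {x = x} {y} {z} x≡z y≡z n = trans (pick-cong {x = x} {z} {y} {z} x≡z y≡z n) (pick-same n)

pick-cancel : ∀ n {x y x′ y′ : A} →
              pick n x y ≡ pick n x′ y′ → pick n y x ≡ pick n y′ x′ → x ≡ x′ × y ≡ y′
pick-cancel n e e′ with isEven n
... | true  = e , e′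
... | false = e′ , e

pick-pointwise : ∀ n (F : (ℕ → A) → B) f g → F (λ t → pick n (f t) (g t)) ≡ pick n (F f) (F g)
pick-pointwise n F f g with isEven n
... | true  = refl
... | false = refl

cos+sin cos-sin alternating : ℕ → ℤ
cos+sin n = cosCoeff n +ℤ sinCoeff n
cos-sin n = cosCoeff n -ℤ sinCoeff n
alternating n = pick n 1ℤ -1ℤ

cos+sin-suc : ∀ n → cos+sin (suc n) *ℤ alternating n ≡ cos+sin n
cos+sin-suc 0 = refl
cos+sin-suc 1 = refl
cos+sin-suc 2 = refl
cos+sin-suc 3 = refl
cos+sin-suc (suc (suc (suc (suc n)))) = cos+sin-suc n

cos-sin-suc : ∀ n → cos-sin (suc n) *ℤ -ℤ alternating n ≡ cos-sin n
cos-sin-suc 0 = refl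
cos-sin-suc 1 = refl
cos-sin-suc 2 = refl
cos-sin-suc 3 = refl
cos-sin-suc (suc (suc (suc (suc n)))) = cos-sin-suc n

cos±sin-mul : ∀ t j → cos+sin (t + j) *ℤ cos+sin j ≡ pick (t + j) (cos-sin t) (cos+sin t)
                    × cos-sin (t + j) *ℤ cos-sin j ≡ pick (t + j) (cos+sin t) (cos-sin t)
cos±sin-mul 0 0 = refl , refl
cos±sin-mul 0 1 = refl , refl
cos±sin-mul 0 2 = refl , refl
cos±sin-mul 0 3 = refl , refl
cos±sin-mul 0 (suc (suc (suc (suc j)))) = cos±sin-mul 0 j
cos±sin-mul 1 0 = refl , refl
cos±sin-mul 1 1 = refl , refl
cos±sin-mul 1 2 = refl , refl
cos±sin-mul 1 3 = refl , refl
cos±sin-mul 1 (suc (suc (suc (suc j)))) = cos±sin-mul 1 j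
cos±sin-mul 2 0 = refl , refl
cos±sin-mul 2 1 = refl , refl
cos±sin-mul 2 2 = refl , refl
cos±sin-mul 2 3 = refl , refl
cos±sin-mul 2 (suc (suc (suc (suc j)))) = cos±sin-mul 2 j
cos±sin-mul 3 0 = refl , refl
cos±sin-mul 3 1 = refl , refl
cos±sin-mul 3 2 = refl , refl
cos±sin-mul 3 3 = refl , refl
cos±sin-mul 3 (suc (suc (suc (suc j)))) = cos±sin-mul 3 j
cos±sin-mul (suc (suc (suc (suc t)))) j = cos±sin-mul t j

cos±sin-mul-≤ : ∀ {n j} → j ≤ n →
                cos+sin n *ℤ cos+sin j ≡ pick n (cos-sin (n ∸ j)) (cos+sin (n ∸ j))
                × cos-sin n *ℤ cos-sin j ≡ pick n (cos+sin (n ∸ j)) (cos-sin (n ∸ j))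
cos±sin-mul-≤ {n} {j} j≤n = subst
  (λ k → cos+sin k *ℤ cos+sin j ≡ pick k (cos-sin (n ∸ j)) (cos+sin (n ∸ j))
         × cos-sin k *ℤ cos-sin j ≡ pick k (cos+sin (n ∸ j)) (cos-sin (n ∸ j)))
  (ℕ.m∸n+n≡m j≤n) (cos±sin-mul (n ∸ j) j)

Boustrophedon : (ℕ → ℕ → ℤ) → Set
Boustrophedon T = ∀ n k → k ≤ n → T (suc n) (suc k) ≡ T (suc n) k +ℤ T n (n ∸ k)

forward-step : ∀ T → Boustrophedon T → ∀ p q → T (suc (p + q)) (suc p) ≡ T (suc (p + q)) p +ℤ T (p + q) q
forward-step T rec p q =
  trans (rec (p + q) p (ℕ.m≤m+n p q)) (cong (λ k → T (suc (p + q)) p +ℤ T (p + q) k) (ℕ.m+n∸m≡n p q))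

backward-step : ∀ T → Boustrophedon T → ∀ p q →
                T (suc (p + q)) q ≡ T (suc (p + q)) (suc q) -ℤ T (p + q) p
backward-step T rec p q = begin
  T (suc (p + q)) q                                ≡⟨ cancel (T (suc (p + q)) q) (T (p + q) p) ⟩
  T (suc (p + q)) q +ℤ T (p + q) p -ℤ T (p + q) p  ≡⟨ cong (_-ℤ T (p + q) p) recurrence ⟨
  T (suc (p + q)) (suc q) -ℤ T (p + q) p           ∎
  where
  open ≡-Reasoning
  cancel : ∀ x y → x ≡ x +ℤ y -ℤ y
  cancel = solve-∀
  recurrence : T (suc (p + q)) (suc q) ≡ T (suc (p + q)) q +ℤ T (p + q) p
  recurrence =
    trans (rec (p + q) q (ℕ.m≤n+m q p)) (cong (λ k → T (suc (p + q)) q +ℤ T (p + q) k) (ℕ.m+n∸n≡m p q))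

zigzag : (ℕ → ℕ → ℤ) → ℕ → ℕ → ℤ
zigzag T p q = pick (p + q) (T (p + q) q) (T (p + q) p)

zigzag-step : ∀ T → Boustrophedon T → ∀ p q →
              zigzag T (suc p) q ≡ zigzag T p (suc q) +ℤ alternating (p + q) *ℤ zigzag T p q
zigzag-step T rec p q rewrite ℕ.+-suc p q | isEven-suc (p + q) with isEven (p + q)
... | true  = trans (forward-step T rec p q) (cong (T (suc (p + q)) p +ℤ_) (sym (ℤ.*-identityˡ _)))
... | false = trans (backward-step T rec p q) (cong (T (suc (p + q)) (suc q) +ℤ_) (sym (ℤ.-1*i≡-i _)))

mirror-step : ∀ T → Boustrophedon T → ∀ p q →
              zigzag T q (suc p) ≡ zigzag T (suc q) p +ℤ -ℤ alternating (p + q) *ℤ zigzag T q p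
mirror-step T rec p q = begin
  zigzag T q (suc p)
    ≡⟨ cancel (zigzag T q (suc p)) (alternating (q + p)) (zigzag T q p) ⟩
  zigzag T q (suc p) +ℤ alternating (q + p) *ℤ zigzag T q p +ℤ -ℤ alternating (q + p) *ℤ zigzag T q p
    ≡⟨ cong₂ _+ℤ_ (zigzag-step T rec q p) (cong (λ k → -ℤ alternating k *ℤ zigzag T q p) (ℕ.+-comm p q)) ⟨
  zigzag T (suc q) p +ℤ -ℤ alternating (p + q) *ℤ zigzag T q p ∎
  where
  open ≡-Reasoning
  cancel : ∀ x e y → x ≡ x +ℤ e *ℤ y +ℤ -ℤ e *ℤ y
  cancel = solve-∀

zigzag-expansion : ∀ T → Boustrophedon T → ∀ n →
  cos+sin n *ℤ pick n (T n 0) (T n n) ≡ ∑ n (λ j → + (n C j) *ℤ (cos+sin j *ℤ pick j (T j j) (T j 0)))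
zigzag-expansion T rec n =
  subst (λ k → cos+sin n *ℤ pick k (T k 0) (T k n) ≡ ∑ n (λ j → + (n C j) *ℤ (cos+sin j *ℤ zigzag T 0 j)))
        (ℕ.+-identityʳ n)
        (signed-pascal-expansion (zigzag T) alternating cos+sin cos+sin-suc (zigzag-step T rec) n)

mirror-expansion : ∀ T → Boustrophedon T → ∀ n →
  cos-sin n *ℤ pick n (T n n) (T n 0) ≡ ∑ n (λ j → + (n C j) *ℤ (cos-sin j *ℤ pick j (T j 0) (T j j)))
mirror-expansion T rec n =
  trans (signed-pascal-expansion (λ p q → zigzag T q p) (-ℤ_ ∘ alternating) cos-sin cos-sin-suc
                                 (mirror-step T rec) n)
        (∑-cong n λ j _ → cong (λ k → + (n C j) *ℤ (cos-sin j *ℤ pick k (T k 0) (T k j))) (ℕ.+-identityʳ j))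

zigzag-end : ∀ T {m} → Boustrophedon T → (∀ j → pick j (T j j) (T j 0) ≡ m j) → ∀ n →
             pick n (T n 0) (T n n) ≡ pick n (binomialConv m cos-sin n) (binomialConv m cos+sin n)
zigzag-end T {m} rec boundary n = trans
  (untwist n cos+sin m (λ t → pick n (cos-sin t) (cos+sin t))
           (trans (proj₁ (cos±sin-mul 0 n)) (pick-same n))
           (trans (zigzag-expansion T rec n)
                  (∑-cong n λ j _ → cong (λ v → + (n C j) *ℤ (cos+sin j *ℤ v)) (boundary j)))
           (λ j j≤n → proj₁ (cos±sin-mul-≤ j≤n)))
  (pick-pointwise n (λ w → binomialConv m w n) cos-sin cos+sin)

mirror-end : ∀ T {m} → Boustrophedon T → (∀ j → pick j (T j 0) (T j j) ≡ m j) → ∀ n →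
             pick n (T n n) (T n 0) ≡ pick n (binomialConv m cos+sin n) (binomialConv m cos-sin n)
mirror-end T {m} rec boundary n = trans
  (untwist n cos-sin m (λ t → pick n (cos+sin t) (cos-sin t))
           (trans (proj₂ (cos±sin-mul 0 n)) (pick-same n))
           (trans (mirror-expansion T rec n)
                  (∑-cong n λ j _ → cong (λ v → + (n C j) *ℤ (cos-sin j *ℤ v)) (boundary j)))
           (λ j j≤n → proj₂ (cos±sin-mul-≤ j≤n)))
  (pick-pointwise n (λ w → binomialConv m w n) cos+sin cos-sin)

*ₛ-cos-sin : ∀ f → (f *ₛ (cosS -ₛ sinS)) ≈ₛ (f ℚΣ.⋆ egf cos-sin)
*ₛ-cos-sin f n = trans (*ₛ≈⋆ f (cosS -ₛ sinS) n) (ℚΣ.⋆-cong {f = f} (λ _ → refl) (-ₛ-egf cosCoeff sinCoeff) n)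

binomialConv-egf : ∀ a m b → (∀ n → a n ≡ binomialConv m cos-sin n) → (∀ n → b n ≡ binomialConv m cos+sin n) →
                   (egf m *ₛ (cosS -ₛ sinS)) ≈ₛ egf a × (egf b *ₛ (cosS -ₛ sinS)) ≈ₛ ((cosS +ₛ sinS) *ₛ egf a)
binomialConv-egf a m b a≡ b≡ = (λ n → trans (*ₛ-cos-sin (egf m) n) (m⋆cos-sin n)) , λ n → begin
  (egf b *ₛ (cosS -ₛ sinS)) n    ≡⟨ *ₛ-cos-sin (egf b) n ⟩
  (egf b ℚΣ.⋆ egf cos-sin) n     ≡⟨ ℚΣ.⋆-exchange {egf m} {egf cos-sin} {egf cos+sin} m⋆cos-sin m⋆cos+sin n ⟩
  (egf cos+sin ℚΣ.⋆ egf a) n     ≡⟨ ℚΣ.⋆-cong {g = egf a} (+ₛ-egf cosCoeff sinCoeff) (λ _ → refl) n ⟨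
  ((cosS +ₛ sinS) ℚΣ.⋆ egf a) n  ≡⟨ *ₛ≈⋆ (cosS +ₛ sinS) (egf a) n ⟨
  ((cosS +ₛ sinS) *ₛ egf a) n    ∎
  where
  open ≡-Reasoning
  m⋆cos-sin : ∀ n → (egf m ℚΣ.⋆ egf cos-sin) n ≡ egf a n
  m⋆cos-sin n = trans (egf-⋆ m cos-sin n) (egf-cong (λ n → sym (a≡ n)) n)
  m⋆cos+sin : ∀ n → (egf m ℚΣ.⋆ egf cos+sin) n ≡ egf b n
  m⋆cos+sin n = trans (egf-⋆ m cos+sin n) (egf-cong (λ n → sym (b≡ n)) n)

theorem2 : (a m b : ℕ → ℤ) (L R : ℕ → ℕ → ℤ) →
    (∀ i → L (2 * i) 0 ≡ a (2 * i)) →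
    (∀ i → R (2 * i + 1) 0 ≡ a (2 * i + 1)) →
    (∀ i → L (2 * i) (2 * i) ≡ m (2 * i)) →
    (∀ i → R (2 * i) 0 ≡ m (2 * i)) →
    (∀ i → L (2 * i + 1) 0 ≡ m (2 * i + 1)) →
    (∀ i → R (2 * i + 1) (2 * i + 1) ≡ m (2 * i + 1)) →
    (∀ i → L (2 * i + 1) (2 * i + 1) ≡ b (2 * i + 1)) →
    (∀ i → R (2 * i) (2 * i) ≡ b (2 * i)) →
    (∀ n k → k ≤ n → L (suc n) (suc k) ≡ L (suc n) k +ℤ L n (n ∸ k)) →
    (∀ n k → k ≤ n → R (suc n) (suc k) ≡ R (suc n) k +ℤ R n (n ∸ k)) →
    ((egf m *ₛ (cosS -ₛ sinS)) ≈ₛ egf a)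
      × ((egf b *ₛ (cosS -ₛ sinS)) ≈ₛ ((cosS +ₛ sinS) *ₛ egf a))
theorem2 a m b L R aL aR mL mR mL′ mR′ bL bR recL recR =
  binomialConv-egf a m b (λ n → proj₁ (a≡×b≡ n)) (λ n → proj₂ (a≡×b≡ n))
  where
  L-ends : ∀ n → pick n (L n 0) (L n n) ≡ pick n (a n) (b n)
  L-ends = pick-cong aL bL
  R-ends : ∀ n → pick n (R n n) (R n 0) ≡ pick n (b n) (a n)
  R-ends = pick-cong bR aR
  L-boundary : ∀ j → pick j (L j j) (L j 0) ≡ m j
  L-boundary = pick-elim mL mL′
  R-boundary : ∀ j → pick j (R j 0) (R j j) ≡ m j
  R-boundary = pick-elim mR mR′
  a≡×b≡ : ∀ n → a n ≡ binomialConv m cos-sin n × b n ≡ binomialConv m cos+sin n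
  a≡×b≡ n = pick-cancel n (trans (sym (L-ends n)) (zigzag-end L recL L-boundary n))
                          (trans (sym (R-ends n)) (mirror-end R recR R-boundary n))
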